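{- Let $R$ be a $\mathbb{Z}$-dark minimal ceer all of whose equivalence classes are computable, let $\boldsymbol{r}$ be its $\mathcal{I}$-degree, and let $\boldsymbol{s}$ be an $\mathcal{I}$-degree (of a ceer) that is $\le_{\mathcal{I}}$-incomparable with $\boldsymbol{r}$. Then $\boldsymbol{r}\oplus\boldsymbol{s}$ is the least upper bound (join) of $\boldsymbol{r}$ and $\boldsymbol{s}$ in the $\mathcal{I}$-degrees of ceers.
   Context: A ceer is a computably enumerable equivalence relation on $\omega$. $R\le S$ means there is a total computable $f$ with $x\,R\,y\iff f(x)\,S\,f(y)$; $R\equiv S$ means $R\le S\le R$. $\mathrm{Id}$ is equality on $\omega$; for $n\ge1$, $\mathrm{Id}_n$ is congruence mod $n$, $R\oplus\mathrm{Id}_0:=R$; $R\oplus S$ is the uniform join: $2u\,(R\oplus S)\,2v$ iff $u\,R\,v$, $2u+1\,(R\oplus S)\,2v+1$ iff $u\,S\,v$, no even related to an odd; on $\mathcal{I}$-degrees, $\deg_{\mathcal{I}}(R)\oplus\deg_{\mathcal{I}}(S)=\deg_{\mathcal{I}}(R\oplus S)$. A ceer is finite if it has finitely many classes, light if $\mathrm{Id}\le R$, dark if neither. $R\le_{\mathcal{I}}S$ means $R\le S\oplus\mathrm{Id}_k$ for some $k\ge0$; $\equiv_{\mathcal{I}}$ is the induced equivalence, whose classes ($\mathcal{I}$-degrees) are ordered by $\le_{\mathcal{I}}$. A dark minimal ceer is a dark ceer $D$ such that every ceer $X\le D$ is finite or $X\equiv D$. A dark ceer $R$ has minimal $\mathcal{I}$-degree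 if every ceer $X\le_{\mathcal{I}}R$ is finite or satisfies $R\le_{\mathcal{I}}X$. A $\mathbb{Z}$-dark minimal ceer is a dark ceer of minimal $\mathcal{I}$-degree which is not $\equiv_{\mathcal{I}}$ to any dark minimal ceer. -}

module Defs where

open import Data.Nat using (ℕ; zero; suc; _<_; _%_; _/_)
open import Data.Fin using (Fin)
open import Data.Vec using (Vec; []; _∷_; lookup)
open import Data.Product using (Σ; _×_; _,_; ∃)
open import Data.Sum using (_⊎_)
open import Relation.Nullary using (¬_)
open import Relation.Binary.PropositionalEquality using (_≡_)
open import Relation.Binary.Structures using (IsEquivalence)

data PR : ℕ → Set where
  zer  : ∀ {n} → PR n
  sc   : PR 1
  proj : ∀ {n} → Fin n → PR n
  comp : ∀ {n m} → PR m → (Fin m → PR n) → PR n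
  prec : ∀ {n} → PR n → PR (suc (suc n)) → PR (suc n)
  mu   : ∀ {n} → PR (suc n) → PR n

data Eval : ∀ {n} → PR n → Vec ℕ n → ℕ → Set where
  ezer  : ∀ {n} {xs : Vec ℕ n} → Eval zer xs 0
  esuc  : ∀ {x} → Eval sc (x ∷ []) (suc x)
  eproj : ∀ {n} {i : Fin n} {xs} → Eval (proj i) xs (lookup xs i)
  ecomp : ∀ {n m} {f : PR m} {gs : Fin m → PR n} {xs z} (ys : Vec ℕ m) →
          (∀ i → Eval (gs i) xs (lookup ys i)) → Eval f ys z →
          Eval (comp f gs) xs z
  eprec0 : ∀ {n} {f : PR n} {g} {xs z} → Eval f xs z → Eval (prec f g) (0 ∷ xs) z
  eprecS : ∀ {n} {f : PR n} {g} {xs k w z} →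
           Eval (prec f g) (k ∷ xs) w → Eval g (k ∷ w ∷ xs) z →
           Eval (prec f g) (suc k ∷ xs) z
  emu   : ∀ {n} {f : PR (suc n)} {xs k} → Eval f (k ∷ xs) 0 →
          (∀ j → j < k → Σ ℕ λ v → Eval f (j ∷ xs) (suc v)) →
          Eval (mu f) xs k

Computable : (ℕ → ℕ) → Set
Computable f = Σ (PR 1) λ e → ∀ x → Eval e (x ∷ []) (f x)

ComputableSet : (ℕ → Set) → Set
ComputableSet P = Σ (ℕ → ℕ) λ χ → Computable χ × (∀ y → (P y → χ y ≡ 1) × (χ y ≡ 1 → P y))

Rel : Set₁
Rel = ℕ → ℕ → Set

-- c.e. binary relation: the domain of a partial computable function
IsCE : Rel → Set
IsCE R = Σ (PR 2) λ e → ∀ x y → (R x y → ∃ λ v → Eval e (x ∷ y ∷ []) v)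
                               × ((∃ λ v → Eval e (x ∷ y ∷ []) v) → R x y)

IsCeer : Rel → Set
IsCeer R = IsEquivalence R × IsCE R

_≤c_ : Rel → Rel → Set
R ≤c S = Σ (ℕ → ℕ) λ f → Computable f ×
           (∀ x y → (R x y → S (f x) (f y)) × (S (f x) (f y) → R x y))

_≡c_ : Rel → Rel → Set
R ≡c S = R ≤c S × S ≤c R

IdRel : Rel
IdRel x y = x ≡ y

IdMod : (n : ℕ) → .{{_ : Data.Nat.NonZero n}} → Rel
IdMod n x y = x % n ≡ y % n

_⊕_ : Rel → Rel → Rel
(R ⊕ S) a b = (a % 2 ≡ 0 × b % 2 ≡ 0 × R (a / 2) (b / 2))
            ⊎ (a % 2 ≡ 1 × b % 2 ≡ 1 × S (a / 2) (b / 2))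

_⊕Id_ : Rel → ℕ → Rel
R ⊕Id zero = R
R ⊕Id suc k = R ⊕ IdMod (suc k)

_≤I_ : Rel → Rel → Set
R ≤I S = Σ ℕ λ k → R ≤c (S ⊕Id k)

_≡I_ : Rel → Rel → Set
R ≡I S = R ≤I S × S ≤I R

Finite : Rel → Set
Finite R = Σ ℕ λ n → Σ (Fin n → ℕ) λ reps → ∀ x → ∃ λ i → R x (reps i)

Light : Rel → Set
Light R = IdRel ≤c R

Dark : Rel → Set
Dark R = ¬ Finite R × ¬ Light R

DarkMinimal : Rel → Set₁
DarkMinimal D = IsCeer D × Dark D ×
  (∀ X → IsCeer X → X ≤c D → Finite X ⊎ X ≡c D)

MinimalIDegree : Rel → Set₁
MinimalIDegree R = IsCeer R × Dark R ×
  (∀ X → IsCeer X → X ≤I R → Finite X ⊎ R ≤I X)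

ZDarkMinimal : Rel → Set₁
ZDarkMinimal R = MinimalIDegree R ×
  ¬ (Σ Rel λ D → DarkMinimal D × R ≡I D)

ClassesComputable : Rel → Set
ClassesComputable R = ∀ x → ComputableSet (R x)

IsJoinI : Rel → Rel → Set₁
IsJoinI R S = R ≤I (R ⊕ S) × S ≤I (R ⊕ S) ×
  (∀ X → IsCeer X → R ≤I X → S ≤I X → (R ⊕ S) ≤I X)

module Submission where

-- The two upper bounds are the injections x ↦ 2x and y ↦ 2y+1.  For the
-- least upper bound let R ≤ X ⊕ Id_K via f and S ≤ X ⊕ Id_J via g, and call
-- x "met" when f x lands in the X-part X-equivalently to some g y.
-- (1) The met points lie in finitely many R-classes.  A total computable p
--     enumerates them (dovetailing over witnesses y and step counts t); the
--     pullback Z of R along p satisfies Z ≤ R and Z ≤ S, so minimality of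
--     the I-degree of R together with R ≰_I S forces Z to be finite.
--     Excluded middle decides whether any point is met at all.
-- (2) Given finitely many met classes C_0,…,C_{n-1}, all computable, send
--     x ∈ C_i to a private Id-value J+K+i, raise the rest of R's Id-part by
--     J, and keep everything else; this reduces R ⊕ S to X ⊕ Id_{J+K+n}.

open import Defs
open import Level using (0ℓ)
open import Axiom.ExcludedMiddle using (ExcludedMiddle)
open import Data.Nat
open import Data.Nat.Properties
open import Data.Nat.DivMod
open import Data.Fin using (Fin; zero; suc)
open import Data.Vec using (Vec; []; _∷_; lookup; tabulate)
open import Data.Vec.Properties using (lookup∘tabulate; tabulate∘lookup)
open import Data.Product using (Σ; _×_; _,_; proj₁; proj₂)
open import Data.Sum using (_⊎_; inj₁; inj₂; [_,_]′)
open import Data.Empty using (⊥; ⊥-elim)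
open import Data.Unit using (⊤; tt)
open import Data.Maybe using (Maybe; just; nothing; _>>=_; zipWith)
open import Data.Maybe.Properties using (just-injective)
open import Function using (_∘_)
open import Relation.Nullary using (¬_; yes; no)
open import Relation.Binary.Structures using (IsEquivalence)
open import Relation.Binary.Definitions using (tri<; tri≈; tri>)
open import Relation.Binary.PropositionalEquality hiding (J)

Prog : (n : ℕ) → (Vec ℕ n → ℕ) → Set
Prog n F = Σ (PR n) λ e → ∀ xs → Eval e xs (F xs)

ext : ∀ {n F} G → Prog n F → (∀ xs → F xs ≡ G xs) → Prog n G
ext G (e , p) q = e , λ xs → subst (Eval e xs) (q xs) (p xs)

compose : ∀ {n m F} (G : Fin m → Vec ℕ n → ℕ) → Prog m F → ((i : Fin m) → Prog n (G i)) →
          Prog n (λ xs → F (tabulate λ i → G i xs))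
compose G (f , pf) gs = comp f (λ i → proj₁ (gs i)) ,
  λ xs → ecomp (tabulate λ i → G i xs)
    (λ i → subst (Eval (proj₁ (gs i)) xs) (sym (lookup∘tabulate (λ i → G i xs) i)) (proj₂ (gs i) xs))
    (pf _)

unary : (ℕ → ℕ) → Vec ℕ 1 → ℕ
unary f (a ∷ []) = f a

binary : (ℕ → ℕ → ℕ) → Vec ℕ 2 → ℕ
binary f (a ∷ b ∷ []) = f a b

app1 : ∀ {n f G} → Prog 1 (unary f) → Prog n G → Prog n (λ xs → f (G xs))
app1 {G = G} pf pg = compose (λ _ → G) pf (λ _ → pg)

app2 : ∀ {n f G H} → Prog 2 (binary f) → Prog n G → Prog n H → Prog n (λ xs → f (G xs) (H xs))
app2 {n} {f} {G} {H} pf pg ph = compose args pf progs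
  where
  args : Fin 2 → Vec ℕ n → ℕ
  args zero = G
  args (suc _) = H
  progs : (i : Fin 2) → Prog n (args i)
  progs zero = pg
  progs (suc zero) = ph

app3 : ∀ {n F A B C} → Prog 3 F → Prog n A → Prog n B → Prog n C →
       Prog n (λ xs → F (A xs ∷ B xs ∷ C xs ∷ []))
app3 {n} {F} {A} {B} {C} pf pa pb pc = compose args pf progs
  where
  args : Fin 3 → Vec ℕ n → ℕ
  args zero = A
  args (suc zero) = B
  args (suc (suc zero)) = C
  progs : ∀ i → Prog n (args i)
  progs zero = pa
  progs (suc zero) = pb
  progs (suc (suc zero)) = pc

sucP : Prog 1 (unary suc)
sucP = sc , λ { (x ∷ []) → esuc }

projP : ∀ {n} (i : Fin n) → Prog n (λ xs → lookup xs i)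
projP i = proj i , λ xs → eproj

constP : ∀ {n} c → Prog n (λ _ → c)
constP zero = zer , λ _ → ezer
constP (suc c) = app1 sucP (constP c)

primRec : ∀ {n} → (Vec ℕ n → ℕ) → (Vec ℕ (suc (suc n)) → ℕ) → ℕ → Vec ℕ n → ℕ
primRec F G zero xs = F xs
primRec F G (suc k) xs = G (k ∷ primRec F G k xs ∷ xs)

primRecV : ∀ {n} → (Vec ℕ n → ℕ) → (Vec ℕ (suc (suc n)) → ℕ) → Vec ℕ (suc n) → ℕ
primRecV F G (k ∷ xs) = primRec F G k xs

primRecP : ∀ {n F G} → Prog n F → Prog (suc (suc n)) G → Prog (suc n) (primRecV F G)
primRecP {F = F} {G} (f , pf) (g , pg) = prec f g , λ { (k ∷ xs) → go k xs }
  where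
  go : ∀ k xs → Eval (prec f g) (k ∷ xs) (primRec F G k xs)
  go zero xs = eprec0 (pf xs)
  go (suc k) xs = eprecS (go k xs) (pg _)

iterP : ∀ {h} (z : ℕ) {G : Vec ℕ 2 → ℕ} → Prog 2 G →
        (∀ k → primRec (λ _ → z) G k [] ≡ h k) → Prog 1 (unary h)
iterP {h} z pg eq = ext (unary h) (primRecP (constP z) pg) λ { (k ∷ []) → eq k }

addP : Prog 2 (binary _+_)
addP = ext (binary _+_) (primRecP (projP zero) (app1 sucP (projP (suc zero))))
  λ { (a ∷ b ∷ []) → go a b }
  where
  go : ∀ a b → primRec (λ xs → lookup xs zero) (λ xs → suc (lookup xs (suc zero))) a (b ∷ []) ≡ a + b
  go zero b = refl
  go (suc a) b = cong suc (go a b)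

predP : Prog 1 (unary pred)
predP = iterP 0 (projP zero) λ { zero → refl ; (suc k) → refl }

monusP : Prog 2 (binary _∸_)
monusP = ext (binary _∸_) (app2 flipped (projP (suc zero)) (projP zero)) λ { (a ∷ b ∷ []) → refl }
  where
  -- recursion on the subtrahend: a ∸ suc b ≡ pred (a ∸ b)
  go : ∀ b a → primRec (λ xs → lookup xs zero) (λ xs → pred (lookup xs (suc zero))) b (a ∷ []) ≡ a ∸ b
  go zero a = refl
  go (suc b) a = trans (cong pred (go b a)) (pred[m∸n]≡m∸[1+n] a b)
  flipped : Prog 2 (binary λ b a → a ∸ b)
  flipped = ext _ (primRecP (projP zero) (app1 predP (projP (suc zero)))) λ { (b ∷ a ∷ []) → go b a }

mulP : Prog 2 (binary _*_)
mulP = ext (binary _*_) (primRecP (constP 0) (app2 addP (projP (suc (suc zero))) (projP (suc zero))))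
  λ { (a ∷ b ∷ []) → go a b }
  where
  go : ∀ a b → primRec (λ _ → 0) (λ xs → lookup xs (suc (suc zero)) + lookup xs (suc zero)) a (b ∷ []) ≡ a * b
  go zero b = refl
  go (suc a) b = cong (b +_) (go a b)

infixl 6 _+P_ _∸P_
infixl 7 _*P_
_+P_ : ∀ {n F G} → Prog n F → Prog n G → Prog n (λ xs → F xs + G xs)
p +P q = app2 addP p q
_∸P_ : ∀ {n F G} → Prog n F → Prog n G → Prog n (λ xs → F xs ∸ G xs)
p ∸P q = app2 monusP p q
_*P_ : ∀ {n F G} → Prog n F → Prog n G → Prog n (λ xs → F xs * G xs)
p *P q = app2 mulP p q

ifz : ℕ → ℕ → ℕ → ℕ
ifz zero a b = a
ifz (suc _) a b = b

ifz-zero : ∀ {c a b} → c ≡ 0 → ifz c a b ≡ a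
ifz-zero refl = refl

ifz-suc : ∀ {c a b k} → c ≡ suc k → ifz c a b ≡ b
ifz-suc refl = refl

ifzP : ∀ {n C A B} → Prog n C → Prog n A → Prog n B → Prog n (λ xs → ifz (C xs) (A xs) (B xs))
ifzP {C = C} {A} {B} pc pa pb =
  ext _ (pa *P (constP 1 ∸P pc) +P pb *P (constP 1 ∸P (constP 1 ∸P pc))) λ xs → go (C xs) (A xs) (B xs)
  where
  go : ∀ c a b → a * (1 ∸ c) + b * (1 ∸ (1 ∸ c)) ≡ ifz c a b
  go zero a b = trans (cong₂ _+_ (*-identityʳ a) (*-zeroʳ b)) (+-identityʳ a)
  go (suc c) a b rewrite 0∸n≡0 c = trans (cong (_+ b * 1) (*-zeroʳ a)) (*-identityʳ b)

sg : ℕ → ℕ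
sg zero = 0
sg (suc _) = 1

isZero : ℕ → ℕ
isZero zero = 1
isZero (suc _) = 0

isOne : ℕ → ℕ
isOne (suc zero) = 1
isOne _ = 0

sgP : Prog 1 (unary sg)
sgP = ext (unary sg) (constP 1 ∸P (constP 1 ∸P projP zero))
  λ { (zero ∷ []) → refl ; (suc c ∷ []) → cong (1 ∸_) (0∸n≡0 c) }

isZeroP : Prog 1 (unary isZero)
isZeroP = ext (unary isZero) (constP 1 ∸P projP zero) λ { (zero ∷ []) → refl ; (suc c ∷ []) → 0∸n≡0 c }

isOneP : Prog 1 (unary isOne)
isOneP = ext (unary isOne) (app1 isZeroP (projP zero ∸P constP 1) ∸P app1 isZeroP (projP zero))
  λ { (zero ∷ []) → refl ; (suc zero ∷ []) → refl ; (suc (suc c) ∷ []) → refl }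

-- A possibly undefined value coded as a number (0 = undefined).
code : Maybe ℕ → ℕ
code nothing = 0
code (just v) = suc v

sequenceFin : ∀ {m} → (Fin m → Maybe ℕ) → Maybe (Vec ℕ m)
sequenceFin {zero} h = just []
sequenceFin {suc m} h = zipWith _∷_ (h zero) (sequenceFin (h ∘ suc))

runPrec : ∀ {n} → (Vec ℕ n → Maybe ℕ) → (ℕ → ℕ → Vec ℕ n → Maybe ℕ) → ℕ → Vec ℕ n → Maybe ℕ
runPrec F G zero xs = F xs
runPrec F G (suc k) xs = runPrec F G k xs >>= λ w → G k w xs

-- State of a bounded μ-search: 0 = still searching, 1 = stuck on an
-- undefined value, suc (suc j) = found the least zero j.
searchStep : ℕ → Maybe ℕ → ℕ → ℕ
searchStep (suc s) _ _ = suc s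
searchStep zero nothing b = 1
searchStep zero (just zero) b = suc (suc b)
searchStep zero (just (suc _)) b = 0

search : (ℕ → Maybe ℕ) → ℕ → ℕ
search h zero = 0
search h (suc b) = searchStep (search h b) (h b) b

searchResult : ℕ → Maybe ℕ
searchResult (suc (suc j)) = just j
searchResult _ = nothing

-- run e t xs runs e on xs, letting every μ-search inspect only the
-- candidates below t; nothing means "no value found within the bound".
run : ∀ {n} → PR n → ℕ → Vec ℕ n → Maybe ℕ
run zer t xs = just 0
run sc t (x ∷ []) = just (suc x)
run (proj i) t xs = just (lookup xs i)
run (comp f gs) t xs = sequenceFin (λ i → run (gs i) t xs) >>= run f t
run (prec f g) t (k ∷ xs) = runPrec (run f t) (λ a b ys → run g t (a ∷ b ∷ ys)) k xs
run (mu f) t xs = searchResult (search (λ j → run f t (j ∷ xs)) t)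

>>=-just : ∀ {A : Set} (m : Maybe A) (k : A → Maybe ℕ) {v} → (m >>= k) ≡ just v →
           Σ A λ w → m ≡ just w × k w ≡ just v
>>=-just (just w) k eq = w , refl , eq

sequenceFin-just : ∀ {m} (h : Fin m → Maybe ℕ) {ys} → sequenceFin h ≡ just ys → ∀ i → h i ≡ just (lookup ys i)
sequenceFin-just {suc m} h eq i with h zero in e0 | sequenceFin (h ∘ suc) in eq2
sequenceFin-just {suc m} h refl zero | just v | just vs = e0
sequenceFin-just {suc m} h refl (suc i) | just v | just vs = sequenceFin-just (h ∘ suc) eq2 i
sequenceFin-just {suc m} h () i | just v | nothing
sequenceFin-just {suc m} h () i | nothing | _

search-running : ∀ h b → search h b ≡ 0 → ∀ i → i < b → Σ ℕ λ v → h i ≡ just (suc v)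
search-running h (suc b) eq i i<b with search h b in e1 | h b in e2
search-running h (suc b) eq i i<b | zero | just (suc v) with m≤n⇒m<n∨m≡n (≤-pred i<b)
... | inj₁ i<b' = search-running h b e1 i i<b'
... | inj₂ refl = v , e2
search-running h (suc b) () i i<b | zero | nothing
search-running h (suc b) () i i<b | zero | just zero
search-running h (suc b) () i i<b | suc s | _

search-found : ∀ h b j → search h b ≡ suc (suc j) →
               h j ≡ just 0 × (∀ i → i < j → Σ ℕ λ v → h i ≡ just (suc v))
search-found h (suc b) j eq with search h b in e1 | h b in e2
search-found h (suc b) j refl | zero | just zero = e2 , search-running h b e1
search-found h (suc b) j () | zero | nothing
search-found h (suc b) j () | zero | just (suc _)
search-found h (suc b) j eq | suc s | _ = search-found h b j (trans e1 eq)

run-sound : ∀ {n} (e : PR n) t xs v → run e t xs ≡ just v → Eval e xs v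
run-sound zer t xs v refl = ezer
run-sound sc t (x ∷ []) v refl = esuc
run-sound (proj i) t xs v refl = eproj
run-sound (comp f gs) t xs v eq with >>=-just (sequenceFin (λ i → run (gs i) t xs)) (run f t) eq
... | ys , e1 , e2 = ecomp ys (λ i → run-sound (gs i) t xs _ (sequenceFin-just _ e1 i)) (run-sound f t ys v e2)
run-sound (prec f g) t (k ∷ xs) v eq = go k v eq
  where
  go : ∀ k v → runPrec (run f t) (λ a b ys → run g t (a ∷ b ∷ ys)) k xs ≡ just v → Eval (prec f g) (k ∷ xs) v
  go zero v eq = eprec0 (run-sound f t xs v eq)
  go (suc k) v eq with >>=-just (runPrec (run f t) (λ a b ys → run g t (a ∷ b ∷ ys)) k xs) _ eq
  ... | w , e1 , e2 = eprecS (go k w e1) (run-sound g t _ v e2)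
run-sound (mu f) t xs v eq with search (λ j → run f t (j ∷ xs)) t in e1
run-sound (mu f) t xs v refl | suc (suc j) with search-found (λ j → run f t (j ∷ xs)) t j e1
... | h0 , hs = emu (run-sound f t (j ∷ xs) 0 h0)
                    (λ i i<j → proj₁ (hs i i<j) , run-sound f t (i ∷ xs) _ (proj₂ (hs i i<j)))
run-sound (mu f) t xs v () | zero
run-sound (mu f) t xs v () | suc zero

Eventually : (ℕ → Set) → Set
Eventually P = Σ ℕ λ T → ∀ t → T ≤ t → P t

eventually-× : ∀ {P Q : ℕ → Set} → Eventually P → Eventually Q → Eventually (λ t → P t × Q t)
eventually-× (T1 , p) (T2 , q) =
  T1 ⊔ T2 , λ t le → p t (≤-trans (m≤m⊔n T1 T2) le) , q t (≤-trans (m≤n⊔m T1 T2) le)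

eventually-Fin : ∀ {m} (P : Fin m → ℕ → Set) → (∀ i → Eventually (P i)) → Eventually (λ t → ∀ i → P i t)
eventually-Fin {zero} P h = 0 , λ t _ ()
eventually-Fin {suc m} P h with eventually-× (h zero) (eventually-Fin (P ∘ suc) (h ∘ suc))
... | T , p = T , λ { t le zero → proj₁ (p t le) ; t le (suc i) → proj₂ (p t le) i }

eventually-< : ∀ k (P : ∀ i → i < k → ℕ → Set) → (∀ i p → Eventually (P i p)) →
               Eventually (λ t → ∀ i p → P i p t)
eventually-< zero P h = 0 , λ t _ i ()
eventually-< (suc k) P h
  with eventually-× (h k ≤-refl) (eventually-< k (λ i p → P i (m≤n⇒m≤1+n p)) (λ i p → h i (m≤n⇒m≤1+n p)))
... | T , q = T , λ t le i i<sk → go t le i i<sk (m≤n⇒m<n∨m≡n (≤-pred i<sk))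
  where
  go : ∀ t → T ≤ t → ∀ i (i<sk : i < suc k) → i < k ⊎ i ≡ k → P i i<sk t
  go t le i i<sk (inj₁ i<k) = subst (λ z → P i z t) (≤-irrelevant _ _) (proj₂ (q t le) i i<k)
  go t le i i<sk (inj₂ refl) = subst (λ z → P i z t) (≤-irrelevant _ _) (proj₁ (q t le))

sequenceFin-all : ∀ {m} (h : Fin m → Maybe ℕ) (ys : Vec ℕ m) → (∀ i → h i ≡ just (lookup ys i)) →
                  sequenceFin h ≡ just ys
sequenceFin-all {zero} h [] p = refl
sequenceFin-all {suc m} h (y ∷ ys) p rewrite p zero | sequenceFin-all (h ∘ suc) ys (p ∘ suc) = refl

search-before : ∀ h k → (∀ i → i < k → Σ ℕ λ v → h i ≡ just (suc v)) → ∀ b → b ≤ k → search h b ≡ 0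
search-before h k hs zero _ = refl
search-before h k hs (suc b) le rewrite search-before h k hs b (≤-trans (n≤1+n b) le) with hs b le
... | v , eq rewrite eq = refl

search-after : ∀ h k → (∀ i → i < k → Σ ℕ λ v → h i ≡ just (suc v)) → h k ≡ just 0 →
               ∀ b → suc k ≤ b → search h b ≡ suc (suc k)
search-after h k hs h0 (suc b) le with m≤n⇒m<n∨m≡n (≤-pred le)
... | inj₁ k<b rewrite search-after h k hs h0 b k<b = refl
... | inj₂ refl rewrite search-before h k hs k ≤-refl | h0 = refl

run-complete : ∀ {n} {e : PR n} {xs v} → Eval e xs v → Eventually (λ t → run e t xs ≡ just v)
run-complete ezer = 0 , λ _ _ → refl
run-complete esuc = 0 , λ _ _ → refl
run-complete eproj = 0 , λ _ _ → refl
run-complete {e = comp f gs} {xs} (ecomp ys evs ef)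
  with eventually-× (eventually-Fin (λ i t → run (gs i) t xs ≡ just (lookup ys i)) (λ i → run-complete (evs i)))
                    (run-complete ef)
... | T , p = T , λ t le → trans (cong (_>>= run f t) (sequenceFin-all _ ys (proj₁ (p t le))))
                                 (proj₂ (p t le))
run-complete (eprec0 ef) = run-complete ef
run-complete {e = prec f g} {suc k ∷ xs} (eprecS ep eg) with eventually-× (run-complete ep) (run-complete eg)
... | T , p = T , λ t le → trans (cong (_>>= λ w → run g t (k ∷ w ∷ xs)) (proj₁ (p t le)))
                                 (proj₂ (p t le))
run-complete {e = mu f} {xs} {k} (emu e0 es)
  with eventually-× (run-complete e0)
         (eventually-< k (λ i p t → run f t (i ∷ xs) ≡ just (suc (proj₁ (es i p))))
                         (λ i i<k → run-complete (proj₂ (es i i<k))))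
... | T , p = suc k ⊔ T , λ t le →
  let p' = p t (≤-trans (m≤n⊔m (suc k) T) le) in
  cong searchResult (search-after (λ j → run f t (j ∷ xs)) k
         (λ i i<k → proj₁ (es i i<k) , proj₂ p' i i<k) (proj₁ p') t (≤-trans (m≤m⊔n (suc k) T) le))

-- Evaluation is deterministic (two evaluations are both found by one long run).
eval-deterministic : ∀ {n} {e : PR n} {xs v w} → Eval e xs v → Eval e xs w → v ≡ w
eval-deterministic e1 e2 with eventually-× (run-complete e1) (run-complete e2)
... | T , p with p T ≤-refl
... | a , b = just-injective (trans (sym a) b)

-- clock e (t ∷ xs) codes the outcome of the t-bounded run of e on xs.
-- It is computable (indeed primitive recursive), uniformly in e.
clock : ∀ {n} → PR n → Vec ℕ (suc n) → ℕ
clock e (t ∷ xs) = code (run e t xs)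

-- Composition: all argument runs must succeed (product of their signs),
-- then f is run on the decoded argument values.
allPositive : ∀ {m} → (Fin m → ℕ) → ℕ
allPositive {zero} c = 1
allPositive {suc m} c = sg (c zero) * allPositive (c ∘ suc)

allPositiveP : ∀ {N m} (C : Fin m → Vec ℕ N → ℕ) → (∀ i → Prog N (C i)) →
               Prog N (λ v → allPositive (λ i → C i v))
allPositiveP {m = zero} C ps = constP 1
allPositiveP {m = suc m} C ps = app1 sgP (ps zero) *P allPositiveP (C ∘ suc) (ps ∘ suc)

allPositive-just : ∀ {m} (h : Fin m → Maybe ℕ) {ys} → sequenceFin h ≡ just ys →
                   allPositive (code ∘ h) ≡ 1 × tabulate (pred ∘ code ∘ h) ≡ ys
allPositive-just {zero} h {[]} eq = refl , refl
allPositive-just {suc m} h eq with h zero | sequenceFin (h ∘ suc) in e2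
allPositive-just {suc m} h refl | just v | just vs with allPositive-just (h ∘ suc) e2
... | a , b = cong (_+ 0) a , cong (v ∷_) b
allPositive-just {suc m} h () | just v | nothing
allPositive-just {suc m} h () | nothing | _

allPositive-nothing : ∀ {m} (h : Fin m → Maybe ℕ) → sequenceFin h ≡ nothing → allPositive (code ∘ h) ≡ 0
allPositive-nothing {suc m} h eq with h zero | sequenceFin (h ∘ suc) in e2
allPositive-nothing {suc m} h eq | just v | nothing rewrite allPositive-nothing (h ∘ suc) e2 = refl
allPositive-nothing {suc m} h eq | nothing | _ = refl

code-sequenceFin->>= : ∀ {m} (h : Fin m → Maybe ℕ) (K : Vec ℕ m → Maybe ℕ) →
                       allPositive (code ∘ h) * code (K (tabulate (pred ∘ code ∘ h))) ≡ code (sequenceFin h >>= K)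
code-sequenceFin->>= h K with sequenceFin h in eq
... | just ys with allPositive-just h eq
...   | a , b rewrite a | b = +-identityʳ _
code-sequenceFin->>= h K | nothing rewrite allPositive-nothing h eq = refl

clock-comp : ∀ {n m} (f : PR m) (gs : Fin m → PR n) → Prog (suc m) (clock f) →
             (∀ i → Prog (suc n) (clock (gs i))) → Prog (suc n) (clock (comp f gs))
clock-comp {n} {m} f gs pf pgs =
  ext (clock (comp f gs)) (allPositiveP (λ i → clock (gs i)) pgs *P compose args pf argsP)
    λ { (t ∷ xs) → code-sequenceFin->>= (λ i → run (gs i) t xs) (run f t) }
  where
  args : Fin (suc m) → Vec ℕ (suc n) → ℕ
  args zero v = lookup v zero
  args (suc i) v = pred (clock (gs i) v)
  argsP : ∀ i → Prog (suc n) (args i)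
  argsP zero = projP zero
  argsP (suc i) = app1 predP (pgs i)

-- Primitive recursion: iterate the clock of g, starting from the clock
-- of f; a zero (failed) intermediate value stays zero.
precStep : ∀ {n} → PR (suc (suc n)) → Vec ℕ (suc (suc (suc n))) → ℕ
precStep g (s ∷ w ∷ t ∷ xs) = sg w * code (run g t (s ∷ pred w ∷ xs))

precStep-iterates : ∀ {n} (f : PR n) g t k xs →
  primRec (clock f) (precStep g) k (t ∷ xs) ≡ code (runPrec (run f t) (λ a b ys → run g t (a ∷ b ∷ ys)) k xs)
precStep-iterates f g t zero xs = refl
precStep-iterates f g t (suc k) xs rewrite precStep-iterates f g t k xs
  with runPrec (run f t) (λ a b ys → run g t (a ∷ b ∷ ys)) k xs
... | nothing = refl
... | just w = +-identityʳ _

clock-prec : ∀ {n} (f : PR n) (g : PR (suc (suc n))) → Prog (suc n) (clock f) →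
             Prog (suc (suc (suc n))) (clock g) → Prog (suc (suc n)) (clock (prec f g))
clock-prec {n} f g pf pg = ext (clock (prec f g)) (compose swapArgs recP swapArgsP)
  λ { (t ∷ k ∷ xs) → trans (cong (λ z → primRec (clock f) (precStep g) k (t ∷ z)) (tabulate∘lookup xs))
                           (precStep-iterates f g t k xs) }
  where
  gArgs : Fin (suc (suc (suc n))) → Vec ℕ (suc (suc (suc n))) → ℕ
  gArgs zero v = lookup v (suc (suc zero))
  gArgs (suc zero) v = lookup v zero
  gArgs (suc (suc zero)) v = pred (lookup v (suc zero))
  gArgs (suc (suc (suc i))) v = lookup v (suc (suc (suc i)))
  gArgsP : ∀ i → Prog (suc (suc (suc n))) (gArgs i)
  gArgsP zero = projP _
  gArgsP (suc zero) = projP _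
  gArgsP (suc (suc zero)) = app1 predP (projP _)
  gArgsP (suc (suc (suc i))) = projP _
  stepP : Prog (suc (suc (suc n))) (precStep g)
  stepP = ext (precStep g) (app1 sgP (projP (suc zero)) *P compose gArgs pg gArgsP)
    λ { (s ∷ w ∷ t ∷ xs) → cong (λ z → sg w * code (run g t (s ∷ pred w ∷ z))) (tabulate∘lookup xs) }
  recP : Prog (suc (suc n)) (primRecV (clock f) (precStep g))
  recP = primRecP pf stepP
  -- the clock argument t comes first, the recursion variable k second
  swapArgs : Fin (suc (suc n)) → Vec ℕ (suc (suc n)) → ℕ
  swapArgs zero v = lookup v (suc zero)
  swapArgs (suc zero) v = lookup v zero
  swapArgs (suc (suc i)) v = lookup v (suc (suc i))
  swapArgsP : ∀ i → Prog (suc (suc n)) (swapArgs i)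
  swapArgsP zero = projP _
  swapArgsP (suc zero) = projP _
  swapArgsP (suc (suc i)) = projP _

searchStepArith : ℕ → ℕ → ℕ → ℕ
searchStepArith s c b = s + isZero s * (isZero c + isOne c * suc (suc b))

searchStepArith-correct : ∀ s m b → searchStepArith s (code m) b ≡ searchStep s m b
searchStepArith-correct (suc s) m b = +-identityʳ (suc s)
searchStepArith-correct zero nothing b = refl
searchStepArith-correct zero (just zero) b = cong suc (cong suc (trans (+-identityʳ _) (+-identityʳ b)))
searchStepArith-correct zero (just (suc v)) b = refl

code-searchResult : ∀ s → code (searchResult s) ≡ s ∸ 1
code-searchResult zero = refl
code-searchResult (suc zero) = refl
code-searchResult (suc (suc s)) = refl

muStep : ∀ {n} → PR (suc n) → Vec ℕ (suc (suc (suc n))) → ℕ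
muStep f (b ∷ s ∷ t ∷ xs) = searchStepArith s (code (run f t (b ∷ xs))) b

muStep-iterates : ∀ {n} (f : PR (suc n)) t xs b →
                  primRec (λ _ → 0) (muStep f) b (t ∷ xs) ≡ search (λ j → run f t (j ∷ xs)) b
muStep-iterates f t xs zero = refl
muStep-iterates f t xs (suc b) rewrite muStep-iterates f t xs b =
  searchStepArith-correct _ (run f t (b ∷ xs)) b

clock-mu : ∀ {n} (f : PR (suc n)) → Prog (suc (suc n)) (clock f) → Prog (suc n) (clock (mu f))
clock-mu {n} f pf = ext (clock (mu f)) (compose dup recP dupP ∸P constP 1)
  λ { (t ∷ xs) → begin
        primRec (λ _ → 0) (muStep f) t (tabulate (lookup (t ∷ xs))) ∸ 1
          ≡⟨ cong (λ z → primRec (λ _ → 0) (muStep f) t z ∸ 1) (tabulate∘lookup (t ∷ xs)) ⟩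
        primRec (λ _ → 0) (muStep f) t (t ∷ xs) ∸ 1
          ≡⟨ cong (_∸ 1) (muStep-iterates f t xs t) ⟩
        search (λ j → run f t (j ∷ xs)) t ∸ 1
          ≡⟨ sym (code-searchResult _) ⟩
        clock (mu f) (t ∷ xs) ∎ }
  where
  open ≡-Reasoning
  fArgs : Fin (suc (suc n)) → Vec ℕ (suc (suc (suc n))) → ℕ
  fArgs zero v = lookup v (suc (suc zero))
  fArgs (suc zero) v = lookup v zero
  fArgs (suc (suc i)) v = lookup v (suc (suc (suc i)))
  fArgsP : ∀ i → Prog (suc (suc (suc n))) (fArgs i)
  fArgsP zero = projP _
  fArgsP (suc zero) = projP _
  fArgsP (suc (suc i)) = projP _
  stepP : Prog (suc (suc (suc n))) (muStep f)
  stepP = ext (muStep f)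
    (projP (suc zero) +P app1 isZeroP (projP (suc zero)) *P
      (app1 isZeroP fP +P app1 isOneP fP *P app1 sucP (app1 sucP (projP zero))))
    λ { (b ∷ s ∷ t ∷ xs) → cong (λ z → searchStepArith s (code (run f t (b ∷ z))) b) (tabulate∘lookup xs) }
    where
    fP : Prog (suc (suc (suc n))) (λ v → clock f (tabulate λ i → fArgs i v))
    fP = compose fArgs pf fArgsP
  recP : Prog (suc (suc n)) (primRecV (λ _ → 0) (muStep f))
  recP = primRecP (constP 0) stepP
  -- the bound t is both the search length and the clock of f
  dup : Fin (suc (suc n)) → Vec ℕ (suc n) → ℕ
  dup zero v = lookup v zero
  dup (suc i) v = lookup v i
  dupP : ∀ i → Prog (suc n) (dup i)
  dupP zero = projP _
  dupP (suc i) = projP _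

clockP : ∀ {n} (e : PR n) → Prog (suc n) (clock e)
clockP zer = ext (clock zer) (constP 1) λ { (t ∷ xs) → refl }
clockP sc = ext (clock sc) (app1 sucP (app1 sucP (projP (suc zero)))) λ { (t ∷ x ∷ []) → refl }
clockP (proj i) = ext (clock (proj i)) (app1 sucP (projP (suc i))) λ { (t ∷ xs) → refl }
clockP (comp f gs) = clock-comp f gs (clockP f) (λ i → clockP (gs i))
clockP (prec f g) = clock-prec f g (clockP f) (clockP g)
clockP (mu f) = clock-mu f (clockP f)

toProg : ∀ {f} → Computable f → Prog 1 (unary f)
toProg (e , p) = e , λ { (x ∷ []) → p x }

fromProg : ∀ {F} → Prog 1 F → Computable (λ x → F (x ∷ []))
fromProg (e , p) = e , λ x → p (x ∷ [])

computable-∘ : ∀ {f g} → Computable f → Computable g → Computable (λ x → g (f x))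
computable-∘ cf cg = fromProg (app1 (toProg cg) (toProg cf))

-- Residues modulo a positive K, by counting up and wrapping around.
modStep : ℕ → ℕ → ℕ
modStep K r = ifz (K ∸ suc r) 0 (suc r)

suc-%-congruent : ∀ K x .{{_ : NonZero K}} → suc x % K ≡ suc (x % K) % K
suc-%-congruent K x =
  trans (cong (λ z → suc z % K) (m≡m%n+[m/n]*n x K)) ([m+kn]%n≡m%n (suc (x % K)) (x / K) K)

modStep-correct : ∀ K x .{{_ : NonZero K}} → modStep K (x % K) ≡ suc x % K
modStep-correct K x with K ∸ suc (x % K) in eq
... | zero = sym (begin
  suc x % K        ≡⟨ suc-%-congruent K x ⟩
  suc (x % K) % K  ≡⟨ cong (_% K) (≤-antisym (m%n<n x K) (m∸n≡0⇒m≤n eq)) ⟩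
  K % K            ≡⟨ n%n≡0 K ⟩
  0                ∎)
  where open ≡-Reasoning
... | suc _ = sym (trans (suc-%-congruent K x)
                         (m<n⇒m%n≡m (≰⇒> λ le → 0≢1+n (trans (sym (m≤n⇒m∸n≡0 le)) eq))))

modP : ∀ K .{{_ : NonZero K}} → Prog 1 (unary (_% K))
modP K = iterP 0 (ifzP (constP K ∸P app1 sucP (projP (suc zero))) (constP 0) (app1 sucP (projP (suc zero)))) go
  where
  go : ∀ x → primRec (λ _ → 0) (λ v → modStep K (lookup v (suc zero))) x [] ≡ x % K
  go zero = sym (m*n%n≡0 0 K)
  go (suc x) = trans (cong (modStep K) (go x)) (modStep-correct K x)

mod2P : Prog 1 (unary (_% 2))
mod2P = modP 2

-- Halving: ⌊ k+1 /2⌋ = ⌈ k /2⌉ = k ∸ ⌊ k /2⌋.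
⌊n/2⌋≡n/2 : ∀ k → ⌊ k /2⌋ ≡ k / 2
⌊n/2⌋≡n/2 zero = refl
⌊n/2⌋≡n/2 (suc zero) = refl
⌊n/2⌋≡n/2 (suc (suc k)) =
  trans (cong suc (⌊n/2⌋≡n/2 k)) (sym (m/n≡1+[m∸n]/n {suc (suc k)} {2} (s≤s (s≤s z≤n))))

div2P : Prog 1 (unary (_/ 2))
div2P = iterP 0 (projP zero ∸P projP (suc zero)) λ k → trans (go k) (⌊n/2⌋≡n/2 k)
  where
  go : ∀ k → primRec (λ _ → 0) (λ v → lookup v zero ∸ lookup v (suc zero)) k [] ≡ ⌊ k /2⌋
  go zero = refl
  go (suc k) = trans (cong (k ∸_) (go k)) (sym (trans (sym (m+n∸m≡n ⌊ k /2⌋ ⌈ k /2⌉))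
                                                      (cong (_∸ ⌊ k /2⌋) (⌊n/2⌋+⌈n/2⌉≡n k))))

left right : ℕ → ℕ
left s = s * 2
right s = suc (s * 2)

leftP : Prog 1 (unary left)
leftP = ext (unary left) (projP zero *P constP 2) λ { (s ∷ []) → refl }

rightP : Prog 1 (unary right)
rightP = ext (unary right) (app1 sucP leftP) λ { (s ∷ []) → refl }

left-even : ∀ s → left s % 2 ≡ 0
left-even s = m*n%n≡0 s 2

left-half : ∀ s → left s / 2 ≡ s
left-half s = m*n/n≡m s 2

right-odd : ∀ s → right s % 2 ≡ 1
right-odd s = [m+kn]%n≡m%n 1 s 2

right-half : ∀ s → right s / 2 ≡ s
right-half s = trans (+-distrib-/ 1 (s * 2) (subst (λ r → 1 + r < 2) (sym (m*n%n≡0 s 2)) ≤-refl))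
                     (m*n/n≡m s 2)

even-or-odd : ∀ x → (x % 2 ≡ 0 × x ≡ left (x / 2)) ⊎ (x % 2 ≡ 1 × x ≡ right (x / 2))
even-or-odd x with x % 2 in eq | m%n<n x 2
... | zero | _ = inj₁ (refl , trans (m≡m%n+[m/n]*n x 2) (cong (_+ (x / 2) * 2) eq))
... | suc zero | _ = inj₂ (refl , trans (m≡m%n+[m/n]*n x 2) (cong (_+ (x / 2) * 2) eq))
... | suc (suc _) | s≤s (s≤s ())

-- Cantor unpairing a ↦ (first a , second a): a lies on diagonal w with
-- triangle w ≤ a < triangle (w+1), and second a = a ∸ triangle w.
triangle : ℕ → ℕ
triangle zero = 0
triangle (suc w) = triangle w + suc w

diagonal : ℕ → ℕ
diagonal zero = 0
diagonal (suc a) = diagonal a + isZero (triangle (suc (diagonal a)) ∸ suc a)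

second : ℕ → ℕ
second a = a ∸ triangle (diagonal a)

first : ℕ → ℕ
first a = diagonal a ∸ second a

triangleP : Prog 1 (unary triangle)
triangleP = iterP 0 (projP (suc zero) +P app1 sucP (projP zero)) go
  where
  go : ∀ k → primRec (λ _ → 0) (λ v → lookup v (suc zero) + suc (lookup v zero)) k [] ≡ triangle k
  go zero = refl
  go (suc k) = cong (_+ suc k) (go k)

diagonalP : Prog 1 (unary diagonal)
diagonalP = iterP 0 (projP (suc zero) +P
                     app1 isZeroP (app1 triangleP (app1 sucP (projP (suc zero))) ∸P app1 sucP (projP zero))) go
  where
  go : ∀ k → primRec (λ _ → 0)
                     (λ v → lookup v (suc zero) + isZero (triangle (suc (lookup v (suc zero))) ∸ suc (lookup v zero))) k []
             ≡ diagonal k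
  go zero = refl
  go (suc k) rewrite go k = refl

secondP : Prog 1 (unary second)
secondP = ext (unary second) (projP zero ∸P app1 triangleP (app1 diagonalP (projP zero))) λ { (k ∷ []) → refl }

firstP : Prog 1 (unary first)
firstP = ext (unary first) (app1 diagonalP (projP zero) ∸P app1 secondP (projP zero)) λ { (k ∷ []) → refl }

diagonal-bounds : ∀ a → triangle (diagonal a) ≤ a × a < triangle (suc (diagonal a))
diagonal-bounds zero = z≤n , s≤s z≤n
diagonal-bounds (suc a) with diagonal-bounds a | triangle (suc (diagonal a)) ∸ suc a in eq
... | lo , hi | zero = subst (λ z → triangle z ≤ suc a × suc a < triangle (suc z)) (+-comm 1 (diagonal a)) (le , lt)
  where
  le : triangle (suc (diagonal a)) ≤ suc a
  le = m∸n≡0⇒m≤n eq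
  lt : suc a < triangle (suc (suc (diagonal a)))
  lt = subst (λ z → z < triangle (suc (diagonal a)) + suc (suc (diagonal a))) (≤-antisym le hi)
             (m<m+n (triangle (suc (diagonal a))) (s≤s z≤n))
... | lo , hi | suc c = subst (λ z → triangle z ≤ suc a × suc a < triangle (suc z)) (sym (+-identityʳ (diagonal a)))
                              (≤-trans lo (n≤1+n a) , (≰⇒> λ le → 0≢1+n (trans (sym (m≤n⇒m∸n≡0 le)) eq)))

triangle-mono : ∀ u v → u < v → triangle (suc u) ≤ triangle v
triangle-mono u (suc v) (s≤s u≤v) with m≤n⇒m<n∨m≡n u≤v
... | inj₁ u<v = ≤-trans (triangle-mono u v u<v) (m≤m+n (triangle v) (suc v))
... | inj₂ refl = ≤-refl

diagonal-unique : ∀ u v a → triangle u ≤ a → a < triangle (suc u) →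
                  triangle v ≤ a → a < triangle (suc v) → u ≡ v
diagonal-unique u v a l1 h1 l2 h2 with <-cmp u v
... | tri< u<v _ _ = ⊥-elim (<-irrefl refl (<-≤-trans h1 (≤-trans (triangle-mono u v u<v) l2)))
... | tri≈ _ e _ = e
... | tri> _ _ v<u = ⊥-elim (<-irrefl refl (<-≤-trans h2 (≤-trans (triangle-mono v u v<u) l1)))

unpair-surjective : ∀ x y → Σ ℕ λ a → first a ≡ x × second a ≡ y
unpair-surjective x y = a , first≡ , second≡
  where
  a : ℕ
  a = triangle (x + y) + y
  diagonal≡ : diagonal a ≡ x + y
  diagonal≡ = diagonal-unique (diagonal a) (x + y) a (proj₁ (diagonal-bounds a)) (proj₂ (diagonal-bounds a))
                (m≤m+n (triangle (x + y)) y) (+-monoʳ-< (triangle (x + y)) (s≤s (m≤n+m y x)))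
  second≡ : second a ≡ y
  second≡ = trans (cong (λ z → a ∸ triangle z) diagonal≡) (m+n∸m≡n (triangle (x + y)) y)
  first≡ : first a ≡ x
  first≡ = trans (cong (_∸ second a) diagonal≡) (trans (cong ((x + y) ∸_) second≡) (m+n∸n≡m x y))

triple-surjective : ∀ x y t → Σ ℕ λ a → first a ≡ x × first (second a) ≡ y × second (second a) ≡ t
triple-surjective x y t with unpair-surjective y t
... | b , b₁ , b₂ with unpair-surjective x b
...   | a , a₁ , a₂ = a , a₁ , trans (cong first a₂) b₁ , trans (cong second a₂) b₂

Iff : Set → Set → Set
Iff A B = (A → B) × (B → A)

infixr 9 _∘I_
_∘I_ : ∀ {A B C : Set} → Iff B C → Iff A B → Iff A C
(p , q) ∘I (p' , q') = (λ a → p (p' a)) , (λ c → q' (q c))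

symI : ∀ {A B : Set} → Iff A B → Iff B A
symI (p , q) = q , p

bothFalse : ∀ {A B : Set} → ¬ A → ¬ B → Iff A B
bothFalse na nb = (λ a → ⊥-elim (na a)) , (λ b → ⊥-elim (nb b))

Reduces : Rel → (ℕ → ℕ) → Rel → Set
Reduces A f B = ∀ x y → Iff (A x y) (B (f x) (f y))

join-cases : (P : ℕ → ℕ → Set) →
  (∀ u v → P (left u) (left v)) → (∀ u v → P (left u) (right v)) →
  (∀ u v → P (right u) (left v)) → (∀ u v → P (right u) (right v)) → ∀ a b → P a b
join-cases P ll lr rl rr a b with even-or-odd a | even-or-odd b
... | inj₁ (_ , ea) | inj₁ (_ , eb) = subst₂ P (sym ea) (sym eb) (ll (a / 2) (b / 2))
... | inj₁ (_ , ea) | inj₂ (_ , eb) = subst₂ P (sym ea) (sym eb) (lr (a / 2) (b / 2))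
... | inj₂ (_ , ea) | inj₁ (_ , eb) = subst₂ P (sym ea) (sym eb) (rl (a / 2) (b / 2))
... | inj₂ (_ , ea) | inj₂ (_ , eb) = subst₂ P (sym ea) (sym eb) (rr (a / 2) (b / 2))

module _ (A B : Rel) where

  ⊕-left : ∀ u v → Iff ((A ⊕ B) (left u) (left v)) (A u v)
  ⊕-left u v = (λ { (inj₁ (_ , _ , r)) → subst₂ A (left-half u) (left-half v) r
                  ; (inj₂ (e , _)) → ⊥-elim (0≢1+n (trans (sym (left-even u)) e)) })
             , λ r → inj₁ (left-even u , left-even v , subst₂ A (sym (left-half u)) (sym (left-half v)) r)

  ⊕-right : ∀ u v → Iff ((A ⊕ B) (right u) (right v)) (B u v)
  ⊕-right u v = (λ { (inj₂ (_ , _ , r)) → subst₂ B (right-half u) (right-half v) r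
                   ; (inj₁ (e , _)) → ⊥-elim (0≢1+n (trans (sym e) (right-odd u))) })
              , λ r → inj₂ (right-odd u , right-odd v , subst₂ B (sym (right-half u)) (sym (right-half v)) r)

  ⊕-left-right : ∀ u v → ¬ (A ⊕ B) (left u) (right v)
  ⊕-left-right u v (inj₁ (_ , e , _)) = 0≢1+n (trans (sym e) (right-odd v))
  ⊕-left-right u v (inj₂ (e , _)) = 0≢1+n (trans (sym (left-even u)) e)

  ⊕-right-left : ∀ u v → ¬ (A ⊕ B) (right u) (left v)
  ⊕-right-left u v (inj₁ (e , _)) = 0≢1+n (trans (sym e) (right-odd u))
  ⊕-right-left u v (inj₂ (_ , e , _)) = 0≢1+n (trans (sym (left-even v)) e)

  ⊕-even : ∀ a b → a % 2 ≡ 0 → b % 2 ≡ 0 → Iff ((A ⊕ B) a b) (A (a / 2) (b / 2))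
  ⊕-even a b ea eb = (λ { (inj₁ (_ , _ , r)) → r ; (inj₂ (e , _)) → ⊥-elim (0≢1+n (trans (sym ea) e)) })
                   , λ r → inj₁ (ea , eb , r)

  ≤c-⊕-left : A ≤c (A ⊕ B)
  ≤c-⊕-left = left , fromProg leftP , λ u v → symI (⊕-left u v)

  ≤c-⊕-right : B ≤c (A ⊕ B)
  ≤c-⊕-right = right , fromProg rightP , λ u v → symI (⊕-right u v)

≤c-trans : ∀ {A B C : Rel} → A ≤c B → B ≤c C → A ≤c C
≤c-trans (f , cf , rf) (g , cg , rg) = (λ x → g (f x)) , computable-∘ cf cg , λ x y → rg (f x) (f y) ∘I rf x y

≤c-refl : ∀ {A : Rel} → A ≤c A
≤c-refl = (λ x → x) , fromProg (projP zero) , λ x y → (λ r → r) , (λ r → r)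

⊕-mono : ∀ {A A' B B' : Rel} → A ≤c A' → B ≤c B' → (A ⊕ B) ≤c (A' ⊕ B')
⊕-mono {A} {A'} {B} {B'} (p , cp , rp) (q , cq , rq) = φ , cφ ,
  join-cases (λ a b → Iff ((A ⊕ B) a b) ((A' ⊕ B') (φ a) (φ b)))
    (λ u v → subst₂ (λ s t → Iff _ ((A' ⊕ B') s t)) (sym (φ-left u)) (sym (φ-left v))
               (symI (⊕-left A' B' (p u) (p v)) ∘I rp u v ∘I ⊕-left A B u v))
    (λ u v → subst₂ (λ s t → Iff _ ((A' ⊕ B') s t)) (sym (φ-left u)) (sym (φ-right v))
               (bothFalse (⊕-left-right A B u v) (⊕-left-right A' B' (p u) (q v))))
    (λ u v → subst₂ (λ s t → Iff _ ((A' ⊕ B') s t)) (sym (φ-right u)) (sym (φ-left v))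
               (bothFalse (⊕-right-left A B u v) (⊕-right-left A' B' (q u) (p v))))
    (λ u v → subst₂ (λ s t → Iff _ ((A' ⊕ B') s t)) (sym (φ-right u)) (sym (φ-right v))
               (symI (⊕-right A' B' (q u) (q v)) ∘I rq u v ∘I ⊕-right A B u v))
  where
  φ : ℕ → ℕ
  φ a = ifz (a % 2) (left (p (a / 2))) (right (q (a / 2)))
  cφ : Computable φ
  cφ = fromProg (ifzP (app1 mod2P x) (app1 leftP (app1 (toProg cp) (app1 div2P x)))
                                     (app1 rightP (app1 (toProg cq) (app1 div2P x))))
    where
    x : Prog 1 (λ xs → lookup xs zero)
    x = projP zero
  φ-left : ∀ u → φ (left u) ≡ left (p u)
  φ-left u rewrite left-even u | left-half u = refl
  φ-right : ∀ u → φ (right u) ≡ right (q u)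
  φ-right u rewrite right-odd u | right-half u = refl

-- Reducing into X ⊕ Id_k with k = 0 (meaning X itself) can be replaced
-- by reducing into X ⊕ Id_1; so K may be assumed positive.
≤c-⊕Id-positive : ∀ {A X : Rel} k → A ≤c (X ⊕Id k) → Σ ℕ λ K' → A ≤c (X ⊕ IdMod (suc K'))
≤c-⊕Id-positive {A} {X} zero r = 0 , ≤c-trans {A} {X} {X ⊕ IdMod 1} r (≤c-⊕-left X (IdMod 1))
≤c-⊕Id-positive (suc k) r = k , r

-- ≤_I can be followed by ≤c (lifting the second reduction through ⊕ Id_k).
≤I-≤c-trans : ∀ {A B C : Rel} → A ≤I B → B ≤c C → A ≤I C
≤I-≤c-trans {A} {B} {C} (zero , r) r2 = zero , ≤c-trans {A} {B} {C} r r2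
≤I-≤c-trans {A} {B} {C} (suc k , r) r2 =
  suc k , ≤c-trans {A} {B ⊕ IdMod (suc k)} {C ⊕ IdMod (suc k)} r
                   (⊕-mono {B} {C} {IdMod (suc k)} {IdMod (suc k)} r2 (≤c-refl {IdMod (suc k)}))

pullback-ceer : ∀ (Q : Rel) (p : ℕ → ℕ) → IsCeer Q → Computable p → IsCeer (λ a b → Q (p a) (p b))
pullback-ceer Q p (eqQ , eQ , sQ) cp =
  record { refl = IsEquivalence.refl eqQ ; sym = IsEquivalence.sym eqQ ; trans = IsEquivalence.trans eqQ } ,
  comp eQ args , λ a b → enumerates a b , enumerated a b
  where
  pa : Prog 2 (λ v → p (lookup v zero))
  pa = app1 (toProg cp) (projP zero)
  pb : Prog 2 (λ v → p (lookup v (suc zero)))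
  pb = app1 (toProg cp) (projP (suc zero))
  args : Fin 2 → PR 2
  args zero = proj₁ pa
  args (suc zero) = proj₁ pb
  enumerates : ∀ a b → Q (p a) (p b) → Σ ℕ λ v → Eval (comp eQ args) (a ∷ b ∷ []) v
  enumerates a b r with proj₁ (sQ (p a) (p b)) r
  ... | v , ev = v , ecomp (p a ∷ p b ∷ [])
                           (λ { zero → proj₂ pa (a ∷ b ∷ []) ; (suc zero) → proj₂ pb (a ∷ b ∷ []) }) ev
  enumerated : ∀ a b → (Σ ℕ λ v → Eval (comp eQ args) (a ∷ b ∷ []) v) → Q (p a) (p b)
  enumerated a b (v , ecomp (y0 ∷ y1 ∷ []) evs ev)
    rewrite eval-deterministic (evs zero) (proj₂ pa (a ∷ b ∷ []))
          | eval-deterministic (evs (suc zero)) (proj₂ pb (a ∷ b ∷ [])) = proj₂ (sQ (p a) (p b)) (v , ev)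

-- firstClass χs x is the least i with χs i x ≡ 1, or m if there is none.
firstClass : ∀ {m} → (Fin m → ℕ → ℕ) → ℕ → ℕ
firstClass {zero} χs x = 0
firstClass {suc m} χs x = ifz (isOne (χs zero x)) (suc (firstClass (χs ∘ suc) x)) 0

firstClassP : ∀ {m} (χs : Fin m → ℕ → ℕ) → (∀ i → Computable (χs i)) → Prog 1 (unary (firstClass χs))
firstClassP {zero} χs cs = ext (unary (firstClass χs)) (constP 0) λ { (x ∷ []) → refl }
firstClassP {suc m} χs cs = ext (unary (firstClass χs))
  (ifzP (app1 isOneP (app1 (toProg (cs zero)) (projP zero)))
        (app1 sucP (app1 (firstClassP (χs ∘ suc) (cs ∘ suc)) (projP zero))) (constP 0))
  λ { (x ∷ []) → refl }

isOne-cases : ∀ u → (u ≡ 1 × isOne u ≡ 1) ⊎ (u ≢ 1 × isOne u ≡ 0)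
isOne-cases zero = inj₂ ((λ ()) , refl)
isOne-cases (suc zero) = inj₁ (refl , refl)
isOne-cases (suc (suc u)) = inj₂ ((λ ()) , refl)

-- For characteristic functions χs of the R-classes of points cs,
-- firstClass is an R-invariant that separates the classes of the cs.
module ClassIndex (R : Rel) (eqR : IsEquivalence R) where

  open IsEquivalence eqR using () renaming (sym to R-sym; trans to R-trans)

  Characteristic : ∀ {m} → (Fin m → ℕ) → (Fin m → ℕ → ℕ) → Set
  Characteristic {m} cs χs = ∀ i y → (R (cs i) y → χs i y ≡ 1) × (χs i y ≡ 1 → R (cs i) y)

  firstClass-invariant : ∀ {m} (cs : Fin m → ℕ) χs → Characteristic cs χs →
                         ∀ x x' → R x x' → firstClass χs x ≡ firstClass χs x'
  firstClass-invariant {zero} cs χs ch x x' r = refl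
  firstClass-invariant {suc m} cs χs ch x x' r with isOne-cases (χs zero x) | isOne-cases (χs zero x')
  ... | inj₁ (_ , e) | inj₁ (_ , e') rewrite e | e' = refl
  ... | inj₁ (o , _) | inj₂ (nn , _) = ⊥-elim (nn (proj₁ (ch zero x') (R-trans (proj₂ (ch zero x) o) r)))
  ... | inj₂ (nn , _) | inj₁ (o , _) = ⊥-elim (nn (proj₁ (ch zero x) (R-trans (proj₂ (ch zero x') o) (R-sym r))))
  ... | inj₂ (_ , e) | inj₂ (_ , e') rewrite e | e' =
    cong suc (firstClass-invariant (cs ∘ suc) (χs ∘ suc) (ch ∘ suc) x x' r)

  firstClass-separates : ∀ {m} (cs : Fin m → ℕ) χs → Characteristic cs χs →
                         ∀ x x' → firstClass χs x ≡ firstClass χs x' → firstClass χs x < m → R x x'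
  firstClass-separates {zero} cs χs ch x x' eq ()
  firstClass-separates {suc m} cs χs ch x x' eq lt with isOne-cases (χs zero x) | isOne-cases (χs zero x')
  ... | inj₁ (o , e) | inj₁ (o' , e') = R-trans (R-sym (proj₂ (ch zero x) o)) (proj₂ (ch zero x') o')
  ... | inj₁ (_ , e) | inj₂ (_ , e') rewrite e | e' = ⊥-elim (0≢1+n eq)
  ... | inj₂ (_ , e) | inj₁ (_ , e') rewrite e | e' = ⊥-elim (0≢1+n (sym eq))
  ... | inj₂ (_ , e) | inj₂ (_ , e') rewrite e | e' =
    firstClass-separates (cs ∘ suc) (χs ∘ suc) (ch ∘ suc) x x' (suc-injective eq) (≤-pred lt)

  firstClass-found : ∀ {m} (cs : Fin m → ℕ) χs → Characteristic cs χs →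
                     ∀ i x → R (cs i) x → firstClass χs x < m
  firstClass-found {suc m} cs χs ch i x r with isOne-cases (χs zero x)
  ... | inj₁ (_ , e) rewrite e = s≤s z≤n
  firstClass-found {suc m} cs χs ch zero x r | inj₂ (nn , e) = ⊥-elim (nn (proj₁ (ch zero x) r))
  firstClass-found {suc m} cs χs ch (suc i) x r | inj₂ (nn , e) rewrite e =
    s≤s (firstClass-found (cs ∘ suc) (χs ∘ suc) (ch ∘ suc) i x r)

-- A point of X ⊕ Id_N described abstractly: a point u of X, or an Id-value s.
data Tag : Set where
  inX  : ℕ → Tag
  inId : ℕ → Tag

-- The relation that X ⊕ Id_N induces on tags whose Id-values are below N.
TagRel : Rel → Tag → Tag → Set
TagRel X (inX u) (inX v) = X u v
TagRel X (inId s) (inId t) = s ≡ t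
TagRel X _ _ = ⊥

TagRel-sym : ∀ (X : Rel) → (∀ {u v} → X u v → X v u) → ∀ a b → TagRel X a b → TagRel X b a
TagRel-sym X X-sym (inX u) (inX v) r = X-sym r
TagRel-sym X X-sym (inId s) (inId t) r = sym r

-- The tag's Id-value, if any, is below N (so reducing it mod N is harmless).
Below : ℕ → Tag → Set
Below N (inX _) = ⊤
Below N (inId s) = s < N

below-mono : ∀ {M N} → M ≤ N → ∀ a → Below M a → Below N a
below-mono M≤N (inX _) tt = tt
below-mono M≤N (inId s) s<M = <-≤-trans s<M M≤N

encode : Tag → ℕ
encode (inX u) = left u
encode (inId s) = right s

encode-faithful : ∀ (X : Rel) N .{{_ : NonZero N}} a b → Below N a → Below N b →
                  Iff ((X ⊕ IdMod N) (encode a) (encode b)) (TagRel X a b)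
encode-faithful X N (inX u) (inX v) _ _ = ⊕-left X (IdMod N) u v
encode-faithful X N (inX u) (inId t) _ _ = bothFalse (⊕-left-right X (IdMod N) u t) λ ()
encode-faithful X N (inId s) (inX v) _ _ = bothFalse (⊕-right-left X (IdMod N) s v) λ ()
encode-faithful X N (inId s) (inId t) s<N t<N =
  ((λ e → trans (sym (m<n⇒m%n≡m s<N)) (trans e (m<n⇒m%n≡m t<N))) , cong (_% N)) ∘I ⊕-right X (IdMod N) s t

ifTag : ℕ → Tag → Tag → Tag
ifTag zero a b = a
ifTag (suc _) a b = b

ifTag-zero : ∀ {c a b} → c ≡ 0 → ifTag c a b ≡ a
ifTag-zero refl = refl

ifTag-suc : ∀ {c a b k} → c ≡ suc k → ifTag c a b ≡ b
ifTag-suc refl = refl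

ifTagP : ∀ {n C} {A B : Vec ℕ n → Tag} → Prog n C → Prog n (encode ∘ A) → Prog n (encode ∘ B) →
         Prog n (λ xs → encode (ifTag (C xs) (A xs) (B xs)))
ifTagP {C = C} {A} {B} pc pa pb = ext _ (ifzP pc pa pb) λ xs → encode-ifTag (C xs) (A xs) (B xs)
  where
  encode-ifTag : ∀ c a b → ifz c (encode a) (encode b) ≡ encode (ifTag c a b)
  encode-ifTag zero a b = refl
  encode-ifTag (suc _) a b = refl

-- The tag of a point of X ⊕ Id_K, with its Id-value raised by J.
decodeFrom : ℕ → (K : ℕ) .{{_ : NonZero K}} → ℕ → Tag
decodeFrom J K a = ifTag (a % 2) (inX (a / 2)) (inId (J + (a / 2) % K))

module _ (J K : ℕ) .{{_ : NonZero K}} where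

  decodeFrom-left : ∀ u → decodeFrom J K (left u) ≡ inX u
  decodeFrom-left u rewrite left-even u | left-half u = refl

  decodeFrom-right : ∀ s → decodeFrom J K (right s) ≡ inId (J + s % K)
  decodeFrom-right s rewrite right-odd s | right-half s = refl

  decodeFrom-faithful : ∀ (X : Rel) a b → Iff ((X ⊕ IdMod K) a b) (TagRel X (decodeFrom J K a) (decodeFrom J K b))
  decodeFrom-faithful X = join-cases (λ a b → Iff ((X ⊕ IdMod K) a b) (TagRel X (decodeFrom J K a) (decodeFrom J K b)))
    (λ u v → subst₂ (λ s t → Iff _ (TagRel X s t)) (sym (decodeFrom-left u)) (sym (decodeFrom-left v))
               (⊕-left X (IdMod K) u v))
    (λ u v → subst₂ (λ s t → Iff _ (TagRel X s t)) (sym (decodeFrom-left u)) (sym (decodeFrom-right v))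
               (bothFalse (⊕-left-right X (IdMod K) u v) λ ()))
    (λ u v → subst₂ (λ s t → Iff _ (TagRel X s t)) (sym (decodeFrom-right u)) (sym (decodeFrom-left v))
               (bothFalse (⊕-right-left X (IdMod K) u v) λ ()))
    (λ u v → subst₂ (λ s t → Iff _ (TagRel X s t)) (sym (decodeFrom-right u)) (sym (decodeFrom-right v))
               ((cong (J +_) , +-cancelˡ-≡ J _ _) ∘I ⊕-right X (IdMod K) u v))

  decodeFrom-cases : ∀ a → (a % 2 ≡ 0 × decodeFrom J K a ≡ inX (a / 2))
                         ⊎ (Σ ℕ λ r → r < K × decodeFrom J K a ≡ inId (J + r))
  decodeFrom-cases a with a % 2 in eq
  ... | zero = inj₁ (refl , refl)
  ... | suc _ = inj₂ ((a / 2) % K , m%n<n (a / 2) K , refl)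

  decodeFrom-below : ∀ a → Below (J + K) (decodeFrom J K a)
  decodeFrom-below a with decodeFrom-cases a
  ... | inj₁ (_ , e) rewrite e = tt
  ... | inj₂ (r , r<K , e) rewrite e = +-monoʳ-< J r<K

  decodeFromP : Prog 1 (unary (encode ∘ decodeFrom J K))
  decodeFromP = ext (unary (encode ∘ decodeFrom J K))
    (ifTagP {A = λ xs → inX (lookup xs zero / 2)} {B = λ xs → inId (J + (lookup xs zero / 2) % K)}
            (app1 mod2P (projP zero)) (app1 leftP (app1 div2P (projP zero)))
            (app1 rightP (constP J +P app1 (modP K) (app1 div2P (projP zero)))))
    λ { (a ∷ []) → refl }

Meets : Rel → (ℕ → ℕ) → (ℕ → ℕ) → ℕ → ℕ → Set
Meets X f g x y = f x % 2 ≡ 0 × g y % 2 ≡ 0 × X (f x / 2) (g y / 2)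

-- If R ≤ X ⊕ Id_K via f, S ≤ X ⊕ Id_J via g, and the points of R that
-- meet some point of S lie in the R-classes of c 0, …, c (n-1), then
-- R ⊕ S ≤ X ⊕ Id_{J+K+n}: covered x goes to the private Id-value J+K+i
-- of its class, the rest of R keeps its image with Id-values raised by J,
-- and S keeps its image.
module JoinReduction (R S X : Rel) (cR : IsCeer R) (classes : ClassesComputable R) (cX : IsCeer X)
  (K' J' : ℕ) (f g : ℕ → ℕ) (cf : Computable f) (cg : Computable g)
  (rf : Reduces R f (X ⊕ IdMod (suc K'))) (rg : Reduces S g (X ⊕ IdMod (suc J')))
  (n : ℕ) (c : Fin n → ℕ) (cover : ∀ x y → Meets X f g x y → Σ (Fin n) λ i → R (c i) x)
  where

  open ClassIndex R (proj₁ cR)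
  open IsEquivalence (proj₁ cR) using () renaming (sym to R-sym)
  open IsEquivalence (proj₁ cX) using () renaming (sym to X-sym)

  K J N : ℕ
  K = suc K'
  J = suc J'
  N = J + K + n

  χ : Fin n → ℕ → ℕ
  χ i = proj₁ (classes (c i))

  χ-characteristic : Characteristic c χ
  χ-characteristic i = proj₂ (proj₂ (classes (c i)))

  -- index x < n exactly when x is covered, and then names its class.
  index : ℕ → ℕ
  index = firstClass χ

  tagR tagS tag : ℕ → Tag
  tagR x = ifTag (n ∸ index x) (decodeFrom J K (f x)) (inId (J + K + index x))
  tagS y = decodeFrom 0 J (g y)
  tag z = ifTag (z % 2) (tagR (z / 2)) (tagS (z / 2))

  data Covered (x : ℕ) : Set where
    covered   : index x < n → tagR x ≡ inId (J + K + index x) → Covered x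
    uncovered : ¬ index x < n → tagR x ≡ decodeFrom J K (f x) → Covered x

  covered? : ∀ x → Covered x
  covered? x with n ∸ index x in eq
  ... | zero = uncovered (λ lt → <-irrefl refl (<-≤-trans lt (m∸n≡0⇒m≤n eq))) (ifTag-zero eq)
  ... | suc _ = covered (≰⇒> λ le → 0≢1+n (trans (sym (m≤n⇒m∸n≡0 le)) eq)) (ifTag-suc eq)

  retag : ∀ {a b a' b' P} → a ≡ a' → b ≡ b' → Iff (TagRel X a' b') P → Iff (TagRel X a b) P
  retag refl refl p = p

  private-apart : ∀ i a → Below (J + K) a → ¬ TagRel X (inId (J + K + i)) a
  private-apart i (inId s) s<JK refl = <-irrefl refl (<-≤-trans s<JK (m≤m+n (J + K) i))

  -- All tags have Id-values below N, so encoding them into X ⊕ Id_N is faithful.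
  tagS-below : ∀ y → Below J (tagS y)
  tagS-below y = decodeFrom-below 0 J (g y)

  tagR-below : ∀ x → Below N (tagR x)
  tagR-below x with covered? x
  ... | covered lt e rewrite e = +-monoʳ-< (J + K) lt
  ... | uncovered _ e rewrite e = below-mono (m≤m+n (J + K) n) _ (decodeFrom-below J K (f x))

  tag-below : ∀ z → Below N (tag z)
  tag-below z with z % 2
  ... | zero = tagR-below (z / 2)
  ... | suc _ = below-mono (≤-trans (m≤m+n J K) (m≤m+n (J + K) n)) _ (tagS-below (z / 2))

  -- Covered points are compared by their class index, the others through f.
  tagR-faithful : ∀ x x' → Iff (TagRel X (tagR x) (tagR x')) (R x x')
  tagR-faithful x x' with covered? x | covered? x'
  ... | covered lt e | covered lt' e' = retag e e'
          (((λ eq → firstClass-separates c χ χ-characteristic x x' eq lt) ,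
            firstClass-invariant c χ χ-characteristic x x')
          ∘I (+-cancelˡ-≡ (J + K) _ _ , cong (J + K +_)))
  ... | covered lt e | uncovered nlt' e' = retag e e' (bothFalse
          (private-apart (index x) _ (decodeFrom-below J K (f x')))
          (λ r → nlt' (subst (_< n) (firstClass-invariant c χ χ-characteristic x x' r) lt)))
  ... | uncovered nlt e | covered lt' e' = retag e e' (bothFalse
          (λ r → private-apart (index x') _ (decodeFrom-below J K (f x))
                   (TagRel-sym X X-sym (decodeFrom J K (f x)) (inId (J + K + index x')) r))
          (λ r → nlt (subst (_< n) (firstClass-invariant c χ χ-characteristic x' x (R-sym r)) lt')))
  ... | uncovered _ e | uncovered _ e' = retag e e' (symI (rf x x') ∘I symI (decodeFrom-faithful J K X (f x) (f x')))

  tagS-faithful : ∀ y y' → Iff (TagRel X (tagS y) (tagS y')) (S y y')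
  tagS-faithful y y' = symI (rg y y') ∘I symI (decodeFrom-faithful 0 J X (g y) (g y'))

  -- Only met points could be related across the join, and those are covered.
  tagR-tagS-apart : ∀ x y → ¬ TagRel X (tagR x) (tagS y)
  tagR-tagS-apart x y with covered? x
  ... | covered _ e rewrite e = private-apart (index x) _
                                  (below-mono (m≤m+n J K) _ (tagS-below y))
  ... | uncovered nlt e rewrite e with decodeFrom-cases J K (f x) | decodeFrom-cases 0 J (g y)
  ...   | inj₁ (ex , e1) | inj₁ (ey , e2) rewrite e1 | e2 =
          λ r → nlt (firstClass-found c χ χ-characteristic _ x (proj₂ (cover x y (ex , ey , r))))
  ...   | inj₁ (_ , e1) | inj₂ (_ , _ , e2) rewrite e1 | e2 = λ ()
  ...   | inj₂ (_ , _ , e1) | inj₁ (_ , e2) rewrite e1 | e2 = λ ()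
  ...   | inj₂ (r , _ , e1) | inj₂ (r' , r'<J , e2) rewrite e1 | e2 =
          λ eq → <-irrefl (sym eq) (<-≤-trans r'<J (m≤m+n J r))

  tag-faithful : ∀ z z' → Iff (TagRel X (tag z) (tag z')) ((R ⊕ S) z z')
  tag-faithful = join-cases (λ z z' → Iff (TagRel X (tag z) (tag z')) ((R ⊕ S) z z'))
    (λ u v → retag (tag-left u) (tag-left v) (symI (⊕-left R S u v) ∘I tagR-faithful u v))
    (λ u v → retag (tag-left u) (tag-right v) (bothFalse (tagR-tagS-apart u v) (⊕-left-right R S u v)))
    (λ u v → retag (tag-right u) (tag-left v)
               (bothFalse (λ r → tagR-tagS-apart v u (TagRel-sym X X-sym (tagS u) (tagR v) r))
                          (⊕-right-left R S u v)))
    (λ u v → retag (tag-right u) (tag-right v) (symI (⊕-right R S u v) ∘I tagS-faithful u v))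
    where
    tag-left : ∀ u → tag (left u) ≡ tagR u
    tag-left u rewrite left-even u | left-half u = refl
    tag-right : ∀ u → tag (right u) ≡ tagS u
    tag-right u rewrite right-odd u | right-half u = refl

  encodeTagP : Prog 1 (unary (encode ∘ tag))
  encodeTagP = ext (unary (encode ∘ tag))
    (ifTagP {A = λ xs → tagR (lookup xs zero / 2)} {B = λ xs → tagS (lookup xs zero / 2)}
      (app1 mod2P x) (app1 tagRP (app1 div2P x)) (app1 (decodeFromP 0 J) (app1 (toProg cg) (app1 div2P x))))
    λ { (z ∷ []) → refl }
    where
    x : Prog 1 (λ xs → lookup xs zero)
    x = projP zero
    indexP : Prog 1 (unary index)
    indexP = firstClassP χ (λ i → proj₁ (proj₂ (classes (c i))))
    tagRP : Prog 1 (unary (encode ∘ tagR))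
    tagRP = ext (unary (encode ∘ tagR))
      (ifTagP {A = λ xs → decodeFrom J K (f (lookup xs zero))} {B = λ xs → inId (J + K + index (lookup xs zero))}
        (constP n ∸P app1 indexP x) (app1 (decodeFromP J K) (app1 (toProg cf) x))
        (app1 rightP (constP (J + K) +P app1 indexP x)))
      λ { (z ∷ []) → refl }

  joinReduction : (R ⊕ S) ≤c (X ⊕ IdMod N)
  joinReduction = encode ∘ tag , fromProg encodeTagP ,
    λ z z' → symI (tag-faithful z z' ∘I encode-faithful X N (tag z) (tag z') (tag-below z) (tag-below z'))

-- Given one met pair (x₀, y₀), enumerate all met points: a codes a triple
-- (x, y, t), and p a = x if t steps of the enumeration of X witness that
-- x meets y, else x₀.  The pullback Z of R along p lies below R and below
-- S, so minimality of R and R ≰_I S force Z to be finite.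
module MetPoints (R S X : Rel) (cR : IsCeer R) (cX : IsCeer X) (R≰S : ¬ R ≤I S)
  (minR : ∀ Z → IsCeer Z → Z ≤I R → Finite Z ⊎ R ≤I Z)
  (K' J' : ℕ) (f g : ℕ → ℕ) (cf : Computable f) (cg : Computable g)
  (rf : Reduces R f (X ⊕ IdMod (suc K'))) (rg : Reduces S g (X ⊕ IdMod (suc J')))
  (x₀ y₀ : ℕ) (met₀ : Meets X f g x₀ y₀)
  where

  open IsEquivalence (proj₁ cR) using () renaming (sym to R-sym)
  open IsEquivalence (proj₁ cX) using () renaming (sym to X-sym; trans to X-trans)

  eX : PR 2
  eX = proj₁ (proj₂ cX)

  eX-enumerates : ∀ u v → Iff (X u v) (Σ ℕ λ w → Eval eX (u ∷ v ∷ []) w)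
  eX-enumerates = proj₂ (proj₂ cX)

  witnessed : ℕ → ℕ → ℕ → ℕ
  witnessed x y t = ifz (f x % 2) (ifz (g y % 2) (clock eX (t ∷ f x / 2 ∷ g y / 2 ∷ [])) 0) 0

  check : ℕ → ℕ
  check a = witnessed (first a) (first (second a)) (second (second a))

  p q : ℕ → ℕ
  p a = ifz (check a) x₀ (first a)
  q a = ifz (check a) y₀ (first (second a))

  checkP : Prog 1 (unary check)
  checkP = ext (unary check)
    (ifzP (app1 mod2P (app1 (toProg cf) xP))
          (ifzP (app1 mod2P (app1 (toProg cg) yP))
                (app3 (clockP eX) tP (app1 div2P (app1 (toProg cf) xP)) (app1 div2P (app1 (toProg cg) yP)))
                (constP 0))
          (constP 0))
    λ { (a ∷ []) → refl }
    where
    xP : Prog 1 (λ xs → first (lookup xs zero))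
    yP : Prog 1 (λ xs → first (second (lookup xs zero)))
    tP : Prog 1 (λ xs → second (second (lookup xs zero)))
    xP = app1 firstP (projP zero)
    yP = app1 firstP (app1 secondP (projP zero))
    tP = app1 secondP (app1 secondP (projP zero))

  p-computable : Computable p
  p-computable = fromProg (ifzP (app1 checkP (projP zero)) (constP x₀) (app1 firstP (projP zero)))

  q-computable : Computable q
  q-computable = fromProg (ifzP (app1 checkP (projP zero)) (constP y₀) (app1 firstP (app1 secondP (projP zero))))

  witnessed-meets : ∀ x y t w → witnessed x y t ≡ suc w → Meets X f g x y
  witnessed-meets x y t w eq with f x % 2 in ex | g y % 2 in ey
  ... | zero | zero = refl , refl , proj₂ (eX-enumerates _ _) (w , run-sound eX t _ w (code-just eq))
    where
    code-just : ∀ {m} → code m ≡ suc w → m ≡ just w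
    code-just {just _} refl = refl
  ... | zero | suc _ = ⊥-elim (0≢1+n eq)
  ... | suc _ | _ = ⊥-elim (0≢1+n eq)

  p-meets-q : ∀ a → Meets X f g (p a) (q a)
  p-meets-q a with check a in eq
  ... | zero = met₀
  ... | suc w = witnessed-meets _ _ _ w eq

  -- Every met point is enumerated by p: code it with a witness and the
  -- number of steps after which the run of eX finds the witness.
  p-onto-met : ∀ x y → Meets X f g x y → Σ ℕ λ a → p a ≡ x
  p-onto-met x y (ex , ey , r) = a , trans (ifz-suc check≡) (proj₁ coded)
    where
    evaluation : Σ ℕ λ w → Eval eX (f x / 2 ∷ g y / 2 ∷ []) w
    evaluation = proj₁ (eX-enumerates _ _) r
    t : ℕ
    t = proj₁ (run-complete (proj₂ evaluation))
    run≡ : run eX t (f x / 2 ∷ g y / 2 ∷ []) ≡ just (proj₁ evaluation)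
    run≡ = proj₂ (run-complete (proj₂ evaluation)) t ≤-refl
    a : ℕ
    a = proj₁ (triple-surjective x y t)
    coded : first a ≡ x × first (second a) ≡ y × second (second a) ≡ t
    coded = proj₂ (triple-surjective x y t)
    check≡ : check a ≡ suc (proj₁ evaluation)
    check≡ = begin
      witnessed (first a) (first (second a)) (second (second a))
        ≡⟨ cong₂ (λ u v → witnessed u v (second (second a))) (proj₁ coded) (proj₁ (proj₂ coded)) ⟩
      witnessed x y (second (second a))
        ≡⟨ cong (witnessed x y) (proj₂ (proj₂ coded)) ⟩
      witnessed x y t
        ≡⟨ trans (ifz-zero ex) (trans (ifz-zero ey) (cong code run≡)) ⟩
      suc (proj₁ evaluation) ∎
      where open ≡-Reasoning

  Z : Rel
  Z a b = R (p a) (p b)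

  Z≤R : Z ≤c R
  Z≤R = p , p-computable , λ a b → (λ r → r) , (λ r → r)

  -- p a and q a meet, so R-equivalence of p-values is X-equivalence of
  -- the corresponding g-values, i.e. S-equivalence of q-values.
  Z≤S : Z ≤c S
  Z≤S = q , q-computable , λ a b → Z⇔S a b (p-meets-q a) (p-meets-q b)
    where
    Z⇔S : ∀ a b → Meets X f g (p a) (q a) → Meets X f g (p b) (q b) → Iff (Z a b) (S (q a) (q b))
    Z⇔S a b (fa , ga , xa) (fb , gb , xb) =
      symI (rg (q a) (q b)) ∘I symI (⊕-even X (IdMod (suc J')) (g (q a)) (g (q b)) ga gb)
      ∘I ((λ r → X-trans (X-sym xa) (X-trans r xb)) , (λ r → X-trans xa (X-trans r (X-sym xb))))
      ∘I ⊕-even X (IdMod (suc K')) (f (p a)) (f (p b)) fa fb ∘I rf (p a) (p b)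

  Z-finite : Finite Z
  Z-finite = [ (λ fin → fin) , (λ R≤Z → ⊥-elim (R≰S (≤I-≤c-trans {R} {Z} {S} R≤Z Z≤S))) ]′
               (minR Z (pullback-ceer R p cR p-computable) (0 , Z≤R))

  metCover : Σ ℕ λ n → Σ (Fin n → ℕ) λ c → ∀ x y → Meets X f g x y → Σ (Fin n) λ i → R (c i) x
  metCover = n , (λ i → p (reps i)) , cover
    where
    n : ℕ
    n = proj₁ Z-finite
    reps : Fin n → ℕ
    reps = proj₁ (proj₂ Z-finite)
    cover : ∀ x y → Meets X f g x y → Σ (Fin n) λ i → R (p (reps i)) x
    cover x y m = i , R-sym (subst (λ u → R u (p (reps i))) pa≡x Zai)
      where
      a : ℕ
      a = proj₁ (p-onto-met x y m)
      pa≡x : p a ≡ x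
      pa≡x = proj₂ (p-onto-met x y m)
      i : Fin n
      i = proj₁ (proj₂ (proj₂ Z-finite) a)
      Zai : R (p a) (p (reps i))
      Zai = proj₂ (proj₂ (proj₂ Z-finite) a)

-- Classically, either some point is met (and MetPoints applies) or none
-- is (and the empty cover works).
metCover : ExcludedMiddle 0ℓ → (R S X : Rel) → IsCeer R → IsCeer X → ¬ R ≤I S →
  (∀ Z → IsCeer Z → Z ≤I R → Finite Z ⊎ R ≤I Z) →
  (K' J' : ℕ) (f g : ℕ → ℕ) → Computable f → Computable g →
  Reduces R f (X ⊕ IdMod (suc K')) → Reduces S g (X ⊕ IdMod (suc J')) →
  Σ ℕ λ n → Σ (Fin n → ℕ) λ c → ∀ x y → Meets X f g x y → Σ (Fin n) λ i → R (c i) x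
metCover em R S X cR cX R≰S minR K' J' f g cf cg rf rg with em {Σ ℕ λ x → Σ ℕ λ y → Meets X f g x y}
... | yes (x₀ , y₀ , met₀) = MetPoints.metCover R S X cR cX R≰S minR K' J' f g cf cg rf rg x₀ y₀ met₀
... | no nothing-met = 0 , (λ ()) , λ x y m → ⊥-elim (nothing-met (x , y , m))

lemma3p12 : ExcludedMiddle 0ℓ →
    (R S : Rel) → IsCeer R → ZDarkMinimal R → ClassesComputable R →
    IsCeer S → ¬ (R ≤I S) → ¬ (S ≤I R) →
    IsJoinI R S
lemma3p12 em R S cR zR classes _ R≰S _ = (0 , ≤c-⊕-left R S) , (0 , ≤c-⊕-right R S) , least
  where
  minR : ∀ Z → IsCeer Z → Z ≤I R → Finite Z ⊎ R ≤I Z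
  minR = proj₂ (proj₂ (proj₁ zR))
  least : ∀ X → IsCeer X → R ≤I X → S ≤I X → (R ⊕ S) ≤I X
  least X cX (k , R≤X) (j , S≤X) with ≤c-⊕Id-positive {R} {X} k R≤X | ≤c-⊕Id-positive {S} {X} j S≤X
  ... | K' , (f , cf , rf) | J' , (g , cg , rg) with metCover em R S X cR cX R≰S minR K' J' f g cf cg rf rg
  ... | n , c , cover = suc J' + suc K' + n ,
        JoinReduction.joinReduction R S X cR classes cX K' J' f g cf cg rf rg n c cover
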